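{- Let $G$ be a finite simple graph with $D(G)=2$ and $Det(G)=2$, and let $\{x,y\}$ be a determining set of $G$. Then the transposition $(xy)$, i.e. the permutation of $V(G)$ swapping $x$ and $y$ and fixing every other vertex, is not an automorphism of $G$.
   Context: A vertex coloring is distinguishing if only the identity automorphism preserves it; $D(G)$ is the least number of colors of a distinguishing coloring. A set $S\subseteq V(G)$ is a determining set if the only automorphism fixing every vertex of $S$ is the identity; $Det(G)$ is the minimum size of a determining set. -}

module Defs where

open import Data.Nat using (ℕ; _<_)
open import Data.Fin using (Fin)
open import Data.Fin.Permutation using (Permutation′; _⟨$⟩ʳ_)
open import Data.List using (List; length)
open import Data.List.Relation.Unary.All using (All)
open import Data.Product using (Σ; _×_; ∃; ∃-syntax)
open import Relation.Binary.PropositionalEquality using (_≡_)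
open import Relation.Nullary using (¬_)
open import Level using (0ℓ; suc)

record Graph (n : ℕ) : Set₁ where
  field
    Adj     : Fin n → Fin n → Set
    sym     : ∀ {u v} → Adj u v → Adj v u
    irrefl  : ∀ {v} → ¬ Adj v v

open Graph public

IsAutomorphism : ∀ {n} → Graph n → Permutation′ n → Set
IsAutomorphism G σ = ∀ u v → (Adj G u v → Adj G (σ ⟨$⟩ʳ u) (σ ⟨$⟩ʳ v))
                           × (Adj G (σ ⟨$⟩ʳ u) (σ ⟨$⟩ʳ v) → Adj G u v)

IsIdentity : ∀ {n} → Permutation′ n → Set
IsIdentity σ = ∀ v → σ ⟨$⟩ʳ v ≡ v

Distinguishing : ∀ {n} → Graph n → (k : ℕ) → (Fin n → Fin k) → Set
Distinguishing G k c =
  ∀ σ → IsAutomorphism G σ → (∀ v → c (σ ⟨$⟩ʳ v) ≡ c v) → IsIdentity σ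

DistNumberIs : ∀ {n} → Graph n → ℕ → Set
DistNumberIs G k = (Σ (Fin _ → Fin k) (Distinguishing G k))
                 × (∀ j → j < k → ¬ Σ (Fin _ → Fin j) (Distinguishing G j))

Determining : ∀ {n} → Graph n → List (Fin n) → Set
Determining G S = ∀ σ → IsAutomorphism G σ → All (λ s → σ ⟨$⟩ʳ s ≡ s) S → IsIdentity σ

-- Det(G) = k : some determining set has k elements and no determining set has fewer.
-- (A list of length < k covers every set of size < k; a list with repetitions
-- represents a set of at most its length.)
DetNumberIs : ∀ {n} → Graph n → ℕ → Set
DetNumberIs G k =
  (Σ (List (Fin _)) λ S → (length S ≡ k) × Determining G S)
  × (∀ S → length S < k → ¬ Determining G S)

{-# OPTIONS --safe #-}
-- If the transposition (x y) is an automorphism, every distinguishing 2-colouring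
-- gives x and y different colours. An automorphism σ fixing x but moving y to
-- w = σ y conjugates (x y) into the automorphism (x w), and conjugating that by
-- (x y) gives (y w); so x, y and w would need three distinct colours. Hence
-- every automorphism fixing x also fixes y, and {x} alone is determining,
-- contradicting Det(G) = 2.
module Submission where

open import Defs hiding (sym)
open import Data.Nat using (ℕ; s≤s; z≤n)
open import Data.Fin using (Fin; zero; suc; _≟_)
open import Data.Fin.Permutation
  using (Permutation′; _⟨$⟩ʳ_; _⟨$⟩ˡ_; _∘ₚ_; _≈_; flip; transpose; inverseʳ)
import Data.Fin.Permutation.Components as PC
open import Data.List using (_∷_; [])
open import Data.List.Relation.Unary.All using (_∷_; [])
open import Data.Product using (_,_; proj₁; proj₂)
open import Function.Bundles using (Injection)
open import Function.Definitions using (Injective)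
open import Function.Properties.Inverse using (↔⇒↣)
open import Relation.Nullary using (¬_; yes; no; contradiction)
open import Relation.Binary.PropositionalEquality

private
  variable
    m n k : ℕ
    A : Set

Fin2-≢-≢⇒≡ : {p q r : Fin 2} → p ≢ q → p ≢ r → q ≡ r
Fin2-≢-≢⇒≡ {zero}     {zero}     {_}        p≢q _   = contradiction refl p≢q
Fin2-≢-≢⇒≡ {zero}     {suc zero} {zero}     _   p≢r = contradiction refl p≢r
Fin2-≢-≢⇒≡ {zero}     {suc zero} {suc zero} _   _   = refl
Fin2-≢-≢⇒≡ {suc zero} {suc zero} {_}        p≢q _   = contradiction refl p≢q
Fin2-≢-≢⇒≡ {suc zero} {zero}     {suc zero} _   p≢r = contradiction refl p≢r
Fin2-≢-≢⇒≡ {suc zero} {zero}     {zero}     _   _   = refl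

transpose-matchˡ : (i j : Fin n) → PC.transpose i j i ≡ j
transpose-matchˡ i j with i ≟ i
... | yes _   = refl
... | no i≢i = contradiction refl i≢i

transpose-fixes : {i j k : Fin n} → k ≢ i → k ≢ j → PC.transpose i j k ≡ k
transpose-fixes {i = i} {j} {k} k≢i k≢j with k ≟ i
... | yes k≡i = contradiction k≡i k≢i
... | no _ with k ≟ j
...   | yes k≡j = contradiction k≡j k≢j
...   | no _    = refl

transpose-invariant : (c : Fin n → A) {i j : Fin n} → c i ≡ c j →
                      ∀ k → c (PC.transpose i j k) ≡ c k
transpose-invariant c {i} {j} ci≡cj k with k ≟ i
... | yes refl = sym ci≡cj
... | no _ with k ≟ j
...   | yes refl = ci≡cj
...   | no _     = refl

transpose-natural : (f : Fin m → Fin n) → Injective _≡_ _≡_ f → ∀ i j k →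
                    f (PC.transpose i j k) ≡ PC.transpose (f i) (f j) (f k)
transpose-natural f f-inj i j k with k ≟ i | f k ≟ f i
... | yes _   | yes _      = refl
... | yes k≡i | no fk≢fi  = contradiction (cong f k≡i) fk≢fi
... | no k≢i  | yes fk≡fi = contradiction (f-inj fk≡fi) k≢i
... | no _    | no _ with k ≟ j | f k ≟ f j
...   | yes _   | yes _      = refl
...   | yes k≡j | no fk≢fj  = contradiction (cong f k≡j) fk≢fj
...   | no k≢j  | yes fk≡fj = contradiction (f-inj fk≡fj) k≢j
...   | no _    | no _       = refl

conjugate-transpose : (σ : Permutation′ n) (i j : Fin n) →
                      flip σ ∘ₚ transpose i j ∘ₚ σ ≈ transpose (σ ⟨$⟩ʳ i) (σ ⟨$⟩ʳ j)
conjugate-transpose σ i j k = trans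
  (transpose-natural (σ ⟨$⟩ʳ_) (Injection.injective (↔⇒↣ σ)) i j (σ ⟨$⟩ˡ k))
  (cong (PC.transpose (σ ⟨$⟩ʳ i) (σ ⟨$⟩ʳ j)) (inverseʳ σ))

module _ (G : Graph n) where

  flip-isAutomorphism : ∀ σ → IsAutomorphism G σ → IsAutomorphism G (flip σ)
  flip-isAutomorphism σ σ-aut u v =
      (λ adj → proj₂ (σ-aut (σ ⟨$⟩ˡ u) (σ ⟨$⟩ˡ v))
                 (subst₂ (Adj G) (sym (inverseʳ σ)) (sym (inverseʳ σ)) adj))
    , (λ adj → subst₂ (Adj G) (inverseʳ σ) (inverseʳ σ)
                 (proj₁ (σ-aut (σ ⟨$⟩ˡ u) (σ ⟨$⟩ˡ v)) adj))

  ∘ₚ-isAutomorphism : ∀ σ ρ → IsAutomorphism G σ → IsAutomorphism G ρ →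
                      IsAutomorphism G (σ ∘ₚ ρ)
  ∘ₚ-isAutomorphism _ _ σ-aut ρ-aut u v =
      (λ adj → proj₁ (ρ-aut _ _) (proj₁ (σ-aut u v) adj))
    , (λ adj → proj₂ (σ-aut u v) (proj₂ (ρ-aut _ _) adj))

  ≈-isAutomorphism : ∀ σ ρ → σ ≈ ρ → IsAutomorphism G σ → IsAutomorphism G ρ
  ≈-isAutomorphism _ _ σ≈ρ σ-aut u v =
      (λ adj → subst₂ (Adj G) (σ≈ρ u) (σ≈ρ v) (proj₁ (σ-aut u v) adj))
    , (λ adj → proj₂ (σ-aut u v) (subst₂ (Adj G) (sym (σ≈ρ u)) (sym (σ≈ρ v)) adj))

  conjugate-transpose-isAutomorphism :
    ∀ σ {i j} → IsAutomorphism G σ → IsAutomorphism G (transpose i j) →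
    IsAutomorphism G (transpose (σ ⟨$⟩ʳ i) (σ ⟨$⟩ʳ j))
  conjugate-transpose-isAutomorphism σ {i} {j} σ-aut τ-aut =
    ≈-isAutomorphism (flip σ ∘ₚ transpose i j ∘ₚ σ) (transpose (σ ⟨$⟩ʳ i) (σ ⟨$⟩ʳ j))
      (conjugate-transpose σ i j)
      (∘ₚ-isAutomorphism (flip σ) (transpose i j ∘ₚ σ) (flip-isAutomorphism σ σ-aut)
        (∘ₚ-isAutomorphism (transpose i j) σ τ-aut σ-aut))

  transpose-colours-differ : ∀ {c : Fin n → Fin k} {i j} → Distinguishing G k c →
                             IsAutomorphism G (transpose i j) → i ≢ j → c i ≢ c j
  transpose-colours-differ {c = c} {i} {j} dist τ-aut i≢j ci≡cj =
    i≢j (trans (sym (dist (transpose i j) τ-aut (transpose-invariant c ci≡cj) i))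
               (transpose-matchˡ i j))

  fixes-transpose-partner : ∀ {c : Fin n → Fin 2} {x y} → Distinguishing G 2 c →
                            IsAutomorphism G (transpose x y) →
                            ∀ σ → IsAutomorphism G σ → σ ⟨$⟩ʳ x ≡ x → σ ⟨$⟩ʳ y ≡ y
  fixes-transpose-partner {c} {x} {y} dist τ-aut σ σ-aut σx≡x with x ≟ y | σ ⟨$⟩ʳ y ≟ y
  ... | yes refl | _         = σx≡x
  ... | no _     | yes σy≡y = σy≡y
  ... | no x≢y   | no σy≢y  =
    contradiction (Fin2-≢-≢⇒≡ (differ τ-aut x≢y) (differ xw-aut (≢-sym w≢x)))
                  (differ yw-aut (≢-sym σy≢y))
    where
    differ : ∀ {i j} → IsAutomorphism G (transpose i j) → i ≢ j → c i ≢ c j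
    differ = transpose-colours-differ dist
    w : Fin n
    w = σ ⟨$⟩ʳ y
    w≢x : w ≢ x
    w≢x w≡x = x≢y (Injection.injective (↔⇒↣ σ) (trans σx≡x (sym w≡x)))
    xw-aut : IsAutomorphism G (transpose x w)
    xw-aut = subst (λ z → IsAutomorphism G (transpose z w)) σx≡x
                   (conjugate-transpose-isAutomorphism σ σ-aut τ-aut)
    yw-aut : IsAutomorphism G (transpose y w)
    yw-aut = subst₂ (λ a b → IsAutomorphism G (transpose a b))
                    (transpose-matchˡ x y) (transpose-fixes w≢x σy≢y)
                    (conjugate-transpose-isAutomorphism (transpose x y) τ-aut xw-aut)

lemma5 : ∀ {n} (G : Graph n) → DistNumberIs G 2 → DetNumberIs G 2
       → (x y : Fin n) → Determining G (x ∷ y ∷ [])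
       → ¬ IsAutomorphism G (transpose x y)
lemma5 G ((c , dist) , _) (_ , no-smaller) x y det τ-aut =
  no-smaller (x ∷ []) (s≤s (s≤s z≤n)) x-determining
  where
  x-determining : Determining G (x ∷ [])
  x-determining σ σ-aut (σx≡x ∷ []) =
    det σ σ-aut (σx≡x ∷ fixes-transpose-partner G dist τ-aut σ σ-aut σx≡x ∷ [])
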